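{- For every $m\ge0$, writing $\mathrm{R}(m)=\mathrm{Res}_{\tilde E_6}(\lambda_m)=\sum_\chi\mathrm{R}(m)_\chi\alpha_\chi$, one has $\langle\mathrm{R}(m),\mathrm{R}(m)\rangle=\mathrm{R}(m)_{\chi_0}$.
   Context: $Q(\tilde E_6)$ is the free abelian group with basis $\alpha_\chi$, $\chi\in\{\chi_0,\psi,\psi^2,\mathrm{X},\chi_{\mathrm{std}},\psi\chi_{\mathrm{std}},\psi^2\chi_{\mathrm{std}}\}$ (the irreducible characters of the binary tetrahedral group). The McKay graph (of type $\tilde E_6$) has edges $\chi_0-\chi_{\mathrm{std}}$, $\psi-\psi\chi_{\mathrm{std}}$, $\psi^2-\psi^2\chi_{\mathrm{std}}$, $\chi_{\mathrm{std}}-\mathrm{X}$, $\psi\chi_{\mathrm{std}}-\mathrm{X}$, $\psi^2\chi_{\mathrm{std}}-\mathrm{X}$. For $v=\sum v_\chi\alpha_\chi$, $\langle v,v\rangle=\sum_\chi v_\chi^2-\sum_{\{\chi,\chi'\}\text{ edge}}v_\chi v_{\chi'}$ (the Euler form for any orientation of the graph, evaluated on the diagonal). For $m=2k$ even: $d^0_m=1+\lfloor\frac{k-2}{3}\rfloor$ if $m\equiv0$, $\lfloor\frac{k}{3}\rfloor$ if $m\equiv1$, $1+\lfloor\frac{k-1}{3}\rfloor$ if $m\equiv2\pmod3$; $d_m=\frac{m-2d^0_m}{4}$. For $m=2k+1$ odd: $a_m=0$ if $k=0$, else $1+\lfloor\frac{k-1}{2}\rfloor$; $b_m=m-3a_m$;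 $e^0_m=\lfloor\frac{b_m+1}{3}\rfloor$ if $m\equiv0$, $1+\lfloor\frac{b_m}{3}\rfloor$ if $m\equiv1$, $\lfloor\frac{b_m}{3}\rfloor$ if $m\equiv2\pmod3$; $e_m=\frac{b_m-e^0_m}{2}$. Let $\beta_m=d^0_m\alpha_{\chi_{\mathrm{std}}}+d_m(\alpha_{\psi\chi_{\mathrm{std}}}+\alpha_{\psi^2\chi_{\mathrm{std}}})$ for $m$ even, $\beta_m=a_m\alpha_{\mathrm{X}}+e^0_m\alpha_{\chi_0}+e_m(\alpha_\psi+\alpha_{\psi^2})$ for $m$ odd; $\mathrm{Res}_{\tilde E_6}(\lambda_0)=0$ and $\mathrm{Res}_{\tilde E_6}(\lambda_m)=\mathrm{Res}_{\tilde E_6}(\lambda_{m-1})+\beta_m$ for $m\ge1$ ($\lambda_m=(m,m-1,\dots,1)$). -}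

module Defs where

open import Data.Nat using (ℕ; zero; suc; _+_; _*_; _∸_; _/_; _%_)
open import Data.Integer as ℤ using (ℤ; +_)

-- The seven irreducible characters of the binary tetrahedral group:
-- χ₀, ψ, ψ², X, χstd, ψχstd, ψ²χstd.
data Irr : Set where
  χ₀ ψ ψ² X χstd ψχstd ψ²χstd : Irr

-- An element of Q(Ẽ₆) = ⊕_χ ℤ α_χ, given by its coordinate function.
QE6 : Set
QE6 = Irr → ℤ

sumIrr : (Irr → ℤ) → ℤ
sumIrr f = f χ₀ ℤ.+ f ψ ℤ.+ f ψ² ℤ.+ f X ℤ.+ f χstd ℤ.+ f ψχstd ℤ.+ f ψ²χstd

-- ⟨v,v⟩ = Σ v_χ² − Σ_{edges {χ,χ'}} v_χ v_χ'  for the Ẽ₆ McKay graph.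
⟨_,_⟩ : QE6 → QE6 → ℤ
⟨ v , w ⟩ =
  sumIrr (λ c → v c ℤ.* w c)
  ℤ.- ( v χ₀ ℤ.* w χstd
      ℤ.+ v ψ ℤ.* w ψχstd
      ℤ.+ v ψ² ℤ.* w ψ²χstd
      ℤ.+ v χstd ℤ.* w X
      ℤ.+ v ψχstd ℤ.* w X
      ℤ.+ v ψ²χstd ℤ.* w X )

-- Coefficients for m = 2k even (used only for m ≥ 2, where all the
-- natural-number subtractions below are honest).
d⁰ : ℕ → ℕ
d⁰ m with m % 3
... | 0 = 1 + ((m / 2) ∸ 2) / 3
... | 1 = (m / 2) / 3
... | _ = 1 + ((m / 2) ∸ 1) / 3

d : ℕ → ℕ
d m = (m ∸ 2 * d⁰ m) / 4

a : ℕ → ℕ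
a m with m / 2
... | zero  = 0
... | suc j = 1 + j / 2

b : ℕ → ℕ
b m = m ∸ 3 * a m

e⁰ : ℕ → ℕ
e⁰ m with m % 3
... | 0 = (b m + 1) / 3
... | 1 = 1 + b m / 3
... | _ = b m / 3

e : ℕ → ℕ
e m = (b m ∸ e⁰ m) / 2

β-even : ℕ → QE6
β-even m χstd   = + d⁰ m
β-even m ψχstd  = + d m
β-even m ψ²χstd = + d m
β-even m _      = + 0

β-odd : ℕ → QE6
β-odd m X  = + a m
β-odd m χ₀ = + e⁰ m
β-odd m ψ  = + e m
β-odd m ψ² = + e m
β-odd m _  = + 0

β : ℕ → QE6
β m with m % 2
... | 0 = β-even m
... | _ = β-odd m

R : ℕ → QE6
R zero    c = + 0
R (suc m) c = R m c ℤ.+ β (suc m) c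

module Submission where

-- The dimension vector δ = (1,1,1,3,2,2,2) of the irreducible characters spans the radical
-- of the Ẽ₆ form, so ⟨ v + tδ , v + tδ ⟩ = ⟨ v , v ⟩.  Each coefficient of β grows linearly
-- with period 12: β (s + 12q) = β s + q·δ', where δ' is δ restricted to the support of β s
-- (the even and the odd restriction add up to δ).  Summing over 0 < s ≤ r gives, for r < 12,
--   R (r + 12q) = R r + q·L r + 3q²·δ,
-- so ⟨ R , R ⟩ − R χ₀ is a polynomial in q whose three coefficients vanish by a finite
-- computation: ⟨ R r , R r ⟩ = R r χ₀, the polar term of R r and L r is L r χ₀, and ⟨ L r , L r ⟩ = 3.

open import Defs
open import Data.Integer as ℤ using (ℤ; +_; -_)
import Data.Integer.Properties as ℤ
import Data.Integer.Tactic.RingSolver as ℤ-Solver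
import Data.Nat.Tactic.RingSolver as ℕ-Solver
open import Data.Product using (_×_; _,_)
open import Relation.Binary.PropositionalEquality
open ≡-Reasoning

-- A module of its own, so that ℤ arithmetic is unqualified here and ℕ arithmetic below.
module QE6-Algebra where
  open import Data.Integer using (_+_; _*_; _-_)

  infixl 6 _⊕_
  infixr 7 _⊙_

  _⊕_ : QE6 → QE6 → QE6
  (v ⊕ w) c = v c + w c

  _⊙_ : ℤ → QE6 → QE6
  (t ⊙ v) c = t * v c

  δ : QE6
  δ χ₀     = + 1
  δ ψ      = + 1
  δ ψ²     = + 1
  δ X      = + 3
  δ χstd   = + 2
  δ ψχstd  = + 2
  δ ψ²χstd = + 2

  ⟨⟩-cong : ∀ {v w} → v ≗ w → ⟨ v , v ⟩ ≡ ⟨ w , w ⟩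
  ⟨⟩-cong v≗w rewrite v≗w χ₀ | v≗w ψ | v≗w ψ² | v≗w X | v≗w χstd | v≗w ψχstd | v≗w ψ²χstd = refl

  ⟨⟩-expand : ∀ v w t →
    ⟨ v ⊕ t ⊙ w , v ⊕ t ⊙ w ⟩ ≡ ⟨ v , v ⟩ + t * (⟨ v , w ⟩ + ⟨ w , v ⟩) + t * t * ⟨ w , w ⟩
  ⟨⟩-expand v w t =
    identity t (v χ₀) (v ψ) (v ψ²) (v X) (v χstd) (v ψχstd) (v ψ²χstd)
               (w χ₀) (w ψ) (w ψ²) (w X) (w χstd) (w ψχstd) (w ψ²χstd)
    where
    identity : ∀ t x₀ x₁ x₂ x₃ x₄ x₅ x₆ y₀ y₁ y₂ y₃ y₄ y₅ y₆ →
      (x₀ + t * y₀) * (x₀ + t * y₀) + (x₁ + t * y₁) * (x₁ + t * y₁) + (x₂ + t * y₂) * (x₂ + t * y₂)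
        + (x₃ + t * y₃) * (x₃ + t * y₃) + (x₄ + t * y₄) * (x₄ + t * y₄) + (x₅ + t * y₅) * (x₅ + t * y₅)
        + (x₆ + t * y₆) * (x₆ + t * y₆)
      - ((x₀ + t * y₀) * (x₄ + t * y₄) + (x₁ + t * y₁) * (x₅ + t * y₅) + (x₂ + t * y₂) * (x₆ + t * y₆)
        + (x₄ + t * y₄) * (x₃ + t * y₃) + (x₅ + t * y₅) * (x₃ + t * y₃) + (x₆ + t * y₆) * (x₃ + t * y₃))
      ≡ (x₀ * x₀ + x₁ * x₁ + x₂ * x₂ + x₃ * x₃ + x₄ * x₄ + x₅ * x₅ + x₆ * x₆
          - (x₀ * x₄ + x₁ * x₅ + x₂ * x₆ + x₄ * x₃ + x₅ * x₃ + x₆ * x₃))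
        + t * ((x₀ * y₀ + x₁ * y₁ + x₂ * y₂ + x₃ * y₃ + x₄ * y₄ + x₅ * y₅ + x₆ * y₆
                 - (x₀ * y₄ + x₁ * y₅ + x₂ * y₆ + x₄ * y₃ + x₅ * y₃ + x₆ * y₃))
             + (y₀ * x₀ + y₁ * x₁ + y₂ * x₂ + y₃ * x₃ + y₄ * x₄ + y₅ * x₅ + y₆ * x₆
                 - (y₀ * x₄ + y₁ * x₅ + y₂ * x₆ + y₄ * x₃ + y₅ * x₃ + y₆ * x₃)))
        + t * t * (y₀ * y₀ + y₁ * y₁ + y₂ * y₂ + y₃ * y₃ + y₄ * y₄ + y₅ * y₅ + y₆ * y₆
                    - (y₀ * y₄ + y₁ * y₅ + y₂ * y₆ + y₄ * y₃ + y₅ * y₃ + y₆ * y₃))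
    identity = ℤ-Solver.solve-∀

  δ-radical : ∀ v → ⟨ v , δ ⟩ + ⟨ δ , v ⟩ ≡ + 0
  δ-radical v = identity (v χ₀) (v ψ) (v ψ²) (v X) (v χstd) (v ψχstd) (v ψ²χstd)
    where
    identity : ∀ x₀ x₁ x₂ x₃ x₄ x₅ x₆ →
      (x₀ * + 1 + x₁ * + 1 + x₂ * + 1 + x₃ * + 3 + x₄ * + 2 + x₅ * + 2 + x₆ * + 2
        - (x₀ * + 2 + x₁ * + 2 + x₂ * + 2 + x₄ * + 3 + x₅ * + 3 + x₆ * + 3))
      + (+ 1 * x₀ + + 1 * x₁ + + 1 * x₂ + + 3 * x₃ + + 2 * x₄ + + 2 * x₅ + + 2 * x₆
        - (+ 1 * x₄ + + 1 * x₅ + + 1 * x₆ + + 2 * x₃ + + 2 * x₃ + + 2 * x₃))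
      ≡ + 0
    identity = ℤ-Solver.solve-∀

  ⟨⟩-translate-δ : ∀ v t → ⟨ v ⊕ t ⊙ δ , v ⊕ t ⊙ δ ⟩ ≡ ⟨ v , v ⟩
  ⟨⟩-translate-δ v t = begin
    ⟨ v ⊕ t ⊙ δ , v ⊕ t ⊙ δ ⟩                                  ≡⟨ ⟨⟩-expand v δ t ⟩
    ⟨ v , v ⟩ + t * (⟨ v , δ ⟩ + ⟨ δ , v ⟩) + t * t * + 0       ≡⟨ cong (λ x → ⟨ v , v ⟩ + t * x + t * t * + 0) (δ-radical v) ⟩
    ⟨ v , v ⟩ + t * + 0 + t * t * + 0                           ≡⟨ identity ⟨ v , v ⟩ t ⟩
    ⟨ v , v ⟩                                                   ∎
    where
    identity : ∀ x t → x + t * + 0 + t * t * + 0 ≡ x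
    identity = ℤ-Solver.solve-∀

open QE6-Algebra
open import Data.Nat using (ℕ; zero; suc; _+_; _*_; _∸_; _/_; _%_; _≤_; _<_; z≤n; s≤s; NonZero)
open import Data.Nat.Properties using (*-assoc; *-zeroʳ; +-∸-comm; [m+n]∸[m+o]≡n∸o; +-comm; +-assoc; *-distribˡ-+; ≤ᵇ⇒≤; <⇒≤; ≤-refl)
open import Data.Nat.DivMod using (+-distrib-/-∣ʳ; m*n/n≡m; [m+kn]%n≡m%n; /-monoˡ-≤; m≡m%n+[m/n]*n; m%n<n)
open import Data.Nat.Divisibility using (divides-refl)

[m+q[kn]]/n≡m/n+qk : ∀ m q k n .{{_ : NonZero n}} → (m + q * (k * n)) / n ≡ m / n + q * k
[m+q[kn]]/n≡m/n+qk m q k n = begin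
  (m + q * (k * n)) / n  ≡⟨ cong (λ x → (m + x) / n) (sym (*-assoc q k n)) ⟩
  (m + q * k * n) / n    ≡⟨ +-distrib-/-∣ʳ m (divides-refl (q * k)) ⟩
  m / n + q * k * n / n  ≡⟨ cong (λ x → m / n + x) (m*n/n≡m (q * k) n) ⟩
  m / n + q * k          ∎

[m+q[kn]]%n≡m%n : ∀ m q k n .{{_ : NonZero n}} → (m + q * (k * n)) % n ≡ m % n
[m+q[kn]]%n≡m%n m q k n =
  trans (cong (λ x → (m + x) % n) (sym (*-assoc q k n))) ([m+kn]%n≡m%n m (q * k) n)

[m+q[a+b]]∸[u+qb]≡[m∸u]+qa : ∀ m u q a b → u ≤ m → m + q * (a + b) ∸ (u + q * b) ≡ (m ∸ u) + q * a
[m+q[a+b]]∸[u+qb]≡[m∸u]+qa m u q a b u≤m = begin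
  m + q * (a + b) ∸ (u + q * b)      ≡⟨ cong (λ x → m + x ∸ (u + q * b)) (*-distribˡ-+ q a b) ⟩
  m + (q * a + q * b) ∸ (u + q * b)  ≡⟨ cong₂ _∸_ (sym (+-assoc m (q * a) (q * b))) (+-comm u (q * b)) ⟩
  m + q * a + q * b ∸ (q * b + u)    ≡⟨ cong (_∸ (q * b + u)) (+-comm (m + q * a) (q * b)) ⟩
  q * b + (m + q * a) ∸ (q * b + u)  ≡⟨ [m+n]∸[m+o]≡n∸o (q * b) (m + q * a) u ⟩
  m + q * a ∸ u                      ≡⟨ +-∸-comm (q * a) u≤m ⟩
  (m ∸ u) + q * a                    ∎

[m+q*12]/2≡m/2+q*6 : ∀ m q → (m + q * 12) / 2 ≡ m / 2 + q * 6
[m+q*12]/2≡m/2+q*6 m q = [m+q[kn]]/n≡m/n+qk m q 6 2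

[m+q*12]%2≡m%2 : ∀ m q → (m + q * 12) % 2 ≡ m % 2
[m+q*12]%2≡m%2 m q = [m+q[kn]]%n≡m%n m q 6 2

[m+q*12]%3≡m%3 : ∀ m q → (m + q * 12) % 3 ≡ m % 3
[m+q*12]%3≡m%3 m q = [m+q[kn]]%n≡m%n m q 4 3

third-of-half-shift : ∀ m q c → c ≤ m / 2 → ((m + q * 12) / 2 ∸ c) / 3 ≡ (m / 2 ∸ c) / 3 + q * 2
third-of-half-shift m q c c≤m/2 = begin
  ((m + q * 12) / 2 ∸ c) / 3  ≡⟨ cong (λ x → (x ∸ c) / 3) ([m+q*12]/2≡m/2+q*6 m q) ⟩
  (m / 2 + q * 6 ∸ c) / 3     ≡⟨ cong (_/ 3) (+-∸-comm (q * 6) c≤m/2) ⟩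
  (m / 2 ∸ c + q * 6) / 3     ≡⟨ [m+q[kn]]/n≡m/n+qk (m / 2 ∸ c) q 2 3 ⟩
  (m / 2 ∸ c) / 3 + q * 2     ∎

2≤m/2 : ∀ m → m % 2 ≡ 0 → m % 3 ≡ 0 → 2 ≤ m → 2 ≤ m / 2
2≤m/2 0 _ _ ()
2≤m/2 1 _ _ (s≤s ())
2≤m/2 2 _ () _
2≤m/2 3 () _ _
2≤m/2 m@(suc (suc (suc (suc _)))) _ _ _ = /-monoˡ-≤ {4} {m} 2 (s≤s (s≤s (s≤s (s≤s z≤n))))

d⁰-shift : ∀ m q → m % 2 ≡ 0 → 2 ≤ m → d⁰ (m + q * 12) ≡ d⁰ m + q * 2
d⁰-shift m q even 2≤m rewrite [m+q*12]%3≡m%3 m q with m % 3 in eq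
... | 0           = cong suc (third-of-half-shift m q 2 (2≤m/2 m even eq 2≤m))
... | 1           = third-of-half-shift m q 0 z≤n
... | suc (suc _) = cong suc (third-of-half-shift m q 1 (/-monoˡ-≤ 2 2≤m))

d-shift : ∀ m q → d⁰ (m + q * 12) ≡ d⁰ m + q * 2 → 2 * d⁰ m ≤ m → d (m + q * 12) ≡ d m + q * 2
d-shift m q d⁰-eq 2d⁰≤m = begin
  (m + q * 12 ∸ 2 * d⁰ (m + q * 12)) / 4  ≡⟨ cong (λ x → (m + q * 12 ∸ 2 * x) / 4) d⁰-eq ⟩
  (m + q * 12 ∸ 2 * (d⁰ m + q * 2)) / 4   ≡⟨ cong (λ x → (m + q * 12 ∸ x) / 4) (double (d⁰ m) q) ⟩
  (m + q * 12 ∸ (2 * d⁰ m + q * 4)) / 4   ≡⟨ cong (_/ 4) ([m+q[a+b]]∸[u+qb]≡[m∸u]+qa m (2 * d⁰ m) q 8 4 2d⁰≤m) ⟩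
  (m ∸ 2 * d⁰ m + q * 8) / 4              ≡⟨ [m+q[kn]]/n≡m/n+qk (m ∸ 2 * d⁰ m) q 2 4 ⟩
  d m + q * 2                             ∎
  where
  double : ∀ x q → 2 * (x + q * 2) ≡ 2 * x + q * 4
  double = ℕ-Solver.solve-∀

a-shift : ∀ m q → a (m + q * 12) ≡ a m + q * 3
a-shift m q rewrite [m+q*12]/2≡m/2+q*6 m q with m / 2
... | suc j = cong suc ([m+q[kn]]/n≡m/n+qk j q 3 2)
a-shift m zero    | zero = refl
a-shift m (suc q) | zero = cong suc ([m+q[kn]]/n≡m/n+qk 5 q 3 2)

b-shift : ∀ m q → 3 * a m ≤ m → b (m + q * 12) ≡ b m + q * 3
b-shift m q 3a≤m = begin
  m + q * 12 ∸ 3 * a (m + q * 12)  ≡⟨ cong (λ x → m + q * 12 ∸ 3 * x) (a-shift m q) ⟩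
  m + q * 12 ∸ 3 * (a m + q * 3)   ≡⟨ cong (m + q * 12 ∸_) (triple (a m) q) ⟩
  m + q * 12 ∸ (3 * a m + q * 9)   ≡⟨ [m+q[a+b]]∸[u+qb]≡[m∸u]+qa m (3 * a m) q 3 9 3a≤m ⟩
  b m + q * 3                      ∎
  where
  triple : ∀ x q → 3 * (x + q * 3) ≡ 3 * x + q * 9
  triple = ℕ-Solver.solve-∀

e⁰-shift : ∀ m q → 3 * a m ≤ m → e⁰ (m + q * 12) ≡ e⁰ m + q * 1
e⁰-shift m q 3a≤m rewrite [m+q*12]%3≡m%3 m q with m % 3
... | 0 = begin
  (b (m + q * 12) + 1) / 3  ≡⟨ cong (λ x → (x + 1) / 3) (b-shift m q 3a≤m) ⟩
  (b m + q * 3 + 1) / 3     ≡⟨ cong (_/ 3) (swap (b m) (q * 3) 1) ⟩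
  (b m + 1 + q * 3) / 3     ≡⟨ [m+q[kn]]/n≡m/n+qk (b m + 1) q 1 3 ⟩
  (b m + 1) / 3 + q * 1     ∎
  where
  swap : ∀ x y z → x + y + z ≡ x + z + y
  swap = ℕ-Solver.solve-∀
... | 1 = cong suc (trans (cong (_/ 3) (b-shift m q 3a≤m)) ([m+q[kn]]/n≡m/n+qk (b m) q 1 3))
... | suc (suc _) = trans (cong (_/ 3) (b-shift m q 3a≤m)) ([m+q[kn]]/n≡m/n+qk (b m) q 1 3)

e-shift : ∀ m q → 3 * a m ≤ m → e⁰ m ≤ b m → e (m + q * 12) ≡ e m + q * 1
e-shift m q 3a≤m e⁰≤b = begin
  (b (m + q * 12) ∸ e⁰ (m + q * 12)) / 2  ≡⟨ cong₂ (λ x y → (x ∸ y) / 2) (b-shift m q 3a≤m) (e⁰-shift m q 3a≤m) ⟩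
  (b m + q * 3 ∸ (e⁰ m + q * 1)) / 2      ≡⟨ cong (_/ 2) ([m+q[a+b]]∸[u+qb]≡[m∸u]+qa (b m) (e⁰ m) q 2 1 e⁰≤b) ⟩
  (b m ∸ e⁰ m + q * 2) / 2                ≡⟨ [m+q[kn]]/n≡m/n+qk (b m ∸ e⁰ m) q 1 2 ⟩
  e m + q * 1                             ∎

δ-even : QE6
δ-even χstd   = + 2
δ-even ψχstd  = + 2
δ-even ψ²χstd = + 2
δ-even _      = + 0

δ-odd : QE6
δ-odd χ₀ = + 1
δ-odd ψ  = + 1
δ-odd ψ² = + 1
δ-odd X  = + 3
δ-odd _  = + 0

β-growth : ℕ → QE6
β-growth m with m % 2
... | 0 = δ-even
... | _ = δ-odd

pos-affine : ∀ x q k → + (x + q * k) ≡ + x ℤ.+ + q ℤ.* + k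
pos-affine x q k = cong (λ y → + x ℤ.+ y) (ℤ.pos-* q k)

pos-constant : ∀ q → + 0 ≡ + 0 ℤ.+ + q ℤ.* + 0
pos-constant q = trans (cong +_ (sym (*-zeroʳ q))) (pos-affine 0 q 0)

β-even-shift : ∀ m q → m % 2 ≡ 0 → 2 ≤ m → 2 * d⁰ m ≤ m → β (m + q * 12) ≗ β m ⊕ + q ⊙ δ-even
β-even-shift m q even 2≤m 2d⁰≤m c rewrite [m+q*12]%2≡m%2 m q | even = coordinate c
  where
  d⁰-eq : d⁰ (m + q * 12) ≡ d⁰ m + q * 2
  d⁰-eq = d⁰-shift m q even 2≤m
  coordinate : ∀ c → β-even (m + q * 12) c ≡ β-even m c ℤ.+ + q ℤ.* δ-even c
  coordinate χstd   = trans (cong +_ d⁰-eq) (pos-affine (d⁰ m) q 2)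
  coordinate ψχstd  = trans (cong +_ (d-shift m q d⁰-eq 2d⁰≤m)) (pos-affine (d m) q 2)
  coordinate ψ²χstd = trans (cong +_ (d-shift m q d⁰-eq 2d⁰≤m)) (pos-affine (d m) q 2)
  coordinate χ₀     = pos-constant q
  coordinate ψ      = pos-constant q
  coordinate ψ²     = pos-constant q
  coordinate X      = pos-constant q

β-odd-shift : ∀ m q → m % 2 ≡ 1 → 3 * a m ≤ m → e⁰ m ≤ b m → β (m + q * 12) ≗ β m ⊕ + q ⊙ δ-odd
β-odd-shift m q odd 3a≤m e⁰≤b c rewrite [m+q*12]%2≡m%2 m q | odd = coordinate c
  where
  coordinate : ∀ c → β-odd (m + q * 12) c ≡ β-odd m c ℤ.+ + q ℤ.* δ-odd c
  coordinate X      = trans (cong +_ (a-shift m q)) (pos-affine (a m) q 3)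
  coordinate χ₀     = trans (cong +_ (e⁰-shift m q 3a≤m)) (pos-affine (e⁰ m) q 1)
  coordinate ψ      = trans (cong +_ (e-shift m q 3a≤m e⁰≤b)) (pos-affine (e m) q 1)
  coordinate ψ²     = trans (cong +_ (e-shift m q 3a≤m e⁰≤b)) (pos-affine (e m) q 1)
  coordinate χstd   = pos-constant q
  coordinate ψχstd  = pos-constant q
  coordinate ψ²χstd = pos-constant q

β-periodic : ∀ s q → 1 ≤ s → s ≤ 12 → β (s + q * 12) ≗ β s ⊕ + q ⊙ β-growth s
β-periodic 0  q () _
β-periodic 1  q _ _ = β-odd-shift  1  q refl (≤ᵇ⇒≤ _ _ _) (≤ᵇ⇒≤ _ _ _)
β-periodic 2  q _ _ = β-even-shift 2  q refl (≤ᵇ⇒≤ _ _ _) (≤ᵇ⇒≤ _ _ _)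
β-periodic 3  q _ _ = β-odd-shift  3  q refl (≤ᵇ⇒≤ _ _ _) (≤ᵇ⇒≤ _ _ _)
β-periodic 4  q _ _ = β-even-shift 4  q refl (≤ᵇ⇒≤ _ _ _) (≤ᵇ⇒≤ _ _ _)
β-periodic 5  q _ _ = β-odd-shift  5  q refl (≤ᵇ⇒≤ _ _ _) (≤ᵇ⇒≤ _ _ _)
β-periodic 6  q _ _ = β-even-shift 6  q refl (≤ᵇ⇒≤ _ _ _) (≤ᵇ⇒≤ _ _ _)
β-periodic 7  q _ _ = β-odd-shift  7  q refl (≤ᵇ⇒≤ _ _ _) (≤ᵇ⇒≤ _ _ _)
β-periodic 8  q _ _ = β-even-shift 8  q refl (≤ᵇ⇒≤ _ _ _) (≤ᵇ⇒≤ _ _ _)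
β-periodic 9  q _ _ = β-odd-shift  9  q refl (≤ᵇ⇒≤ _ _ _) (≤ᵇ⇒≤ _ _ _)
β-periodic 10 q _ _ = β-even-shift 10 q refl (≤ᵇ⇒≤ _ _ _) (≤ᵇ⇒≤ _ _ _)
β-periodic 11 q _ _ = β-odd-shift  11 q refl (≤ᵇ⇒≤ _ _ _) (≤ᵇ⇒≤ _ _ _)
β-periodic 12 q _ _ = β-even-shift 12 q refl (≤ᵇ⇒≤ _ _ _) (≤ᵇ⇒≤ _ _ _)
β-periodic (suc (suc (suc (suc (suc (suc (suc (suc (suc (suc (suc (suc (suc _))))))))))))) q _
  (s≤s (s≤s (s≤s (s≤s (s≤s (s≤s (s≤s (s≤s (s≤s (s≤s (s≤s (s≤s ()))))))))))))

β-growth-sum : ℕ → QE6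
β-growth-sum zero    c = + 0
β-growth-sum (suc r) c = β-growth-sum r c ℤ.+ β-growth (suc r) c

β-growth-sum-12 : β-growth-sum 12 ≗ + 6 ⊙ δ
β-growth-sum-12 χ₀     = refl
β-growth-sum-12 ψ      = refl
β-growth-sum-12 ψ²     = refl
β-growth-sum-12 X      = refl
β-growth-sum-12 χstd   = refl
β-growth-sum-12 ψχstd  = refl
β-growth-sum-12 ψ²χstd = refl

R-block : ∀ r → r ≤ 12 → ∀ q → R (r + q * 12) ≗ R (q * 12) ⊕ R r ⊕ + q ⊙ β-growth-sum r
R-block zero    _    q c = identity (R (q * 12) c) (+ q)
  where
  identity : ∀ x t → x ≡ x ℤ.+ + 0 ℤ.+ t ℤ.* + 0
  identity = ℤ-Solver.solve-∀
R-block (suc r) r<12 q c = begin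
  R (r + q * 12) c ℤ.+ β (suc r + q * 12) c
    ≡⟨ cong₂ ℤ._+_ (R-block r (<⇒≤ r<12) q c) (β-periodic (suc r) q (s≤s z≤n) r<12 c) ⟩
  R (q * 12) c ℤ.+ R r c ℤ.+ + q ℤ.* β-growth-sum r c ℤ.+ (β (suc r) c ℤ.+ + q ℤ.* β-growth (suc r) c)
    ≡⟨ identity (R (q * 12) c) (R r c) (β (suc r) c) (+ q) (β-growth-sum r c) (β-growth (suc r) c) ⟩
  R (q * 12) c ℤ.+ (R r c ℤ.+ β (suc r) c) ℤ.+ + q ℤ.* (β-growth-sum r c ℤ.+ β-growth (suc r) c)
    ∎
  where
  identity : ∀ x y z t g h →
    x ℤ.+ y ℤ.+ t ℤ.* g ℤ.+ (z ℤ.+ t ℤ.* h) ≡ x ℤ.+ (y ℤ.+ z) ℤ.+ t ℤ.* (g ℤ.+ h)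
  identity = ℤ-Solver.solve-∀

Λ : QE6
Λ = R 12 ⊕ - + 3 ⊙ δ

R-multiple : ∀ q → R (q * 12) ≗ + q ⊙ Λ ⊕ (+ 3 ℤ.* (+ q ℤ.* + q)) ⊙ δ
R-multiple zero    c = base (R 12 c) (δ c)
  where
  base : ∀ x y → + 0 ≡ + 0 ℤ.* (x ℤ.+ - + 3 ℤ.* y) ℤ.+ + 3 ℤ.* (+ 0 ℤ.* + 0) ℤ.* y
  base = ℤ-Solver.solve-∀
R-multiple (suc q) c = begin
  R (12 + q * 12) c
    ≡⟨ R-block 12 ≤-refl q c ⟩
  R (q * 12) c ℤ.+ R 12 c ℤ.+ + q ℤ.* β-growth-sum 12 c
    ≡⟨ cong₂ (λ x y → x ℤ.+ R 12 c ℤ.+ + q ℤ.* y) (R-multiple q c) (β-growth-sum-12 c) ⟩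
  + q ℤ.* Λ c ℤ.+ + 3 ℤ.* (+ q ℤ.* + q) ℤ.* δ c ℤ.+ R 12 c ℤ.+ + q ℤ.* (+ 6 ℤ.* δ c)
    ≡⟨ step (+ q) (R 12 c) (δ c) ⟩
  + suc q ℤ.* Λ c ℤ.+ + 3 ℤ.* (+ suc q ℤ.* + suc q) ℤ.* δ c
    ∎
  where
  step : ∀ t x y →
    t ℤ.* (x ℤ.+ - + 3 ℤ.* y) ℤ.+ + 3 ℤ.* (t ℤ.* t) ℤ.* y ℤ.+ x ℤ.+ t ℤ.* (+ 6 ℤ.* y)
    ≡ (+ 1 ℤ.+ t) ℤ.* (x ℤ.+ - + 3 ℤ.* y) ℤ.+ + 3 ℤ.* ((+ 1 ℤ.+ t) ℤ.* (+ 1 ℤ.+ t)) ℤ.* y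
  step = ℤ-Solver.solve-∀

L : ℕ → QE6
L r = Λ ⊕ β-growth-sum r

R-closed-form : ∀ r → r ≤ 12 → ∀ q → R (r + q * 12) ≗ R r ⊕ + q ⊙ L r ⊕ (+ 3 ℤ.* (+ q ℤ.* + q)) ⊙ δ
R-closed-form r r≤12 q c = begin
  R (r + q * 12) c
    ≡⟨ R-block r r≤12 q c ⟩
  R (q * 12) c ℤ.+ R r c ℤ.+ + q ℤ.* β-growth-sum r c
    ≡⟨ cong (λ x → x ℤ.+ R r c ℤ.+ + q ℤ.* β-growth-sum r c) (R-multiple q c) ⟩
  + q ℤ.* Λ c ℤ.+ + 3 ℤ.* (+ q ℤ.* + q) ℤ.* δ c ℤ.+ R r c ℤ.+ + q ℤ.* β-growth-sum r c
    ≡⟨ regroup (+ q) (Λ c) (δ c) (R r c) (β-growth-sum r c) ⟩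
  R r c ℤ.+ + q ℤ.* L r c ℤ.+ + 3 ℤ.* (+ q ℤ.* + q) ℤ.* δ c
    ∎
  where
  regroup : ∀ t l y x g →
    t ℤ.* l ℤ.+ + 3 ℤ.* (t ℤ.* t) ℤ.* y ℤ.+ x ℤ.+ t ℤ.* g ≡ x ℤ.+ t ℤ.* (l ℤ.+ g) ℤ.+ + 3 ℤ.* (t ℤ.* t) ℤ.* y
  regroup = ℤ-Solver.solve-∀

ResidueIdentities : ℕ → Set
ResidueIdentities r =
  ⟨ R r , R r ⟩ ≡ R r χ₀ × ⟨ R r , L r ⟩ ℤ.+ ⟨ L r , R r ⟩ ≡ L r χ₀ × ⟨ L r , L r ⟩ ≡ + 3

residue-identities : ∀ r → r < 12 → ResidueIdentities r
residue-identities 0  _ = refl , refl , refl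
residue-identities 1  _ = refl , refl , refl
residue-identities 2  _ = refl , refl , refl
residue-identities 3  _ = refl , refl , refl
residue-identities 4  _ = refl , refl , refl
residue-identities 5  _ = refl , refl , refl
residue-identities 6  _ = refl , refl , refl
residue-identities 7  _ = refl , refl , refl
residue-identities 8  _ = refl , refl , refl
residue-identities 9  _ = refl , refl , refl
residue-identities 10 _ = refl , refl , refl
residue-identities 11 _ = refl , refl , refl
residue-identities (suc (suc (suc (suc (suc (suc (suc (suc (suc (suc (suc (suc _))))))))))))
  (s≤s (s≤s (s≤s (s≤s (s≤s (s≤s (s≤s (s≤s (s≤s (s≤s (s≤s (s≤s ()))))))))))))

norm-R-on-residue : ∀ r → r < 12 → ∀ q → ⟨ R (r + q * 12) , R (r + q * 12) ⟩ ≡ R (r + q * 12) χ₀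
norm-R-on-residue r r<12 q with residue-identities r r<12
... | norm-R , polar-RL , norm-L = begin
  ⟨ R (r + q * 12) , R (r + q * 12) ⟩
    ≡⟨ ⟨⟩-cong (R-closed-form r (<⇒≤ r<12) q) ⟩
  ⟨ R r ⊕ t ⊙ L r ⊕ s ⊙ δ , R r ⊕ t ⊙ L r ⊕ s ⊙ δ ⟩
    ≡⟨ ⟨⟩-translate-δ (R r ⊕ t ⊙ L r) s ⟩
  ⟨ R r ⊕ t ⊙ L r , R r ⊕ t ⊙ L r ⟩
    ≡⟨ ⟨⟩-expand (R r) (L r) t ⟩
  ⟨ R r , R r ⟩ ℤ.+ t ℤ.* (⟨ R r , L r ⟩ ℤ.+ ⟨ L r , R r ⟩) ℤ.+ t ℤ.* t ℤ.* ⟨ L r , L r ⟩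
    ≡⟨ cong₂ (λ x y → x ℤ.+ t ℤ.* y ℤ.+ t ℤ.* t ℤ.* ⟨ L r , L r ⟩) norm-R polar-RL ⟩
  R r χ₀ ℤ.+ t ℤ.* L r χ₀ ℤ.+ t ℤ.* t ℤ.* ⟨ L r , L r ⟩
    ≡⟨ cong (λ z → R r χ₀ ℤ.+ t ℤ.* L r χ₀ ℤ.+ t ℤ.* t ℤ.* z) norm-L ⟩
  R r χ₀ ℤ.+ t ℤ.* L r χ₀ ℤ.+ t ℤ.* t ℤ.* + 3
    ≡⟨ identity (R r χ₀) (L r χ₀) t ⟩
  R r χ₀ ℤ.+ t ℤ.* L r χ₀ ℤ.+ s ℤ.* + 1
    ≡⟨ R-closed-form r (<⇒≤ r<12) q χ₀ ⟨
  R (r + q * 12) χ₀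
    ∎
  where
  t s : ℤ
  t = + q
  s = + 3 ℤ.* (t ℤ.* t)
  identity : ∀ x y t → x ℤ.+ t ℤ.* y ℤ.+ t ℤ.* t ℤ.* + 3 ≡ x ℤ.+ t ℤ.* y ℤ.+ + 3 ℤ.* (t ℤ.* t) ℤ.* + 1
  identity = ℤ-Solver.solve-∀

proposition6p7 : (m : ℕ) → ⟨ R m , R m ⟩ ≡ R m χ₀
proposition6p7 m =
  subst (λ n → ⟨ R n , R n ⟩ ≡ R n χ₀) (sym (m≡m%n+[m/n]*n m 12))
        (norm-R-on-residue (m % 12) (m%n<n m 12) (m / 12))
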